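{- Let $A$ be an alternating sign matrix whose SW key avoids $312$. If $A$ classically contains $321$, then the SW key of $A$ also contains $321$.
   Context: An alternating sign matrix (ASM) of size $n$ is an $n\times n$ matrix with entries in $\{0,1,-1\}$ such that every row and every column sums to $1$ and the nonzero entries of each row and of each column alternate in sign. Position $(i,j)$ is the $i$-th row from the top and $j$-th column from the left. The permutation matrix of $\sigma=\sigma(1)\dots\sigma(n)$ has a $1$ in row $i$, column $\sigma(i)$ for each $i$. A matrix classically contains the permutation $\pi$ of size $k$ if, treating $-1$ entries as $0$, there are rows $r_1<\dots<r_k$ and columns $c_1<\dots<c_k$ such that the entry at $(r_a,c_{\pi(a)})$ is $1$ for all $a$; for permutation matrices this coincides with usual permutation pattern containment ($\sigma$ contains $\pi$ if there are indices $i_1<\dots<i_k$ with $\sigma(i_a)<\sigma(i_b)$ iff $\pi(a)<\pi(b)$; otherwise avoids). SW key process: a $-1$ entry is removable if no other $-1$ entry lies weakly southwest of it. For a removable $-1$ at $(i,j)$, let $(i,j_0)$ be the nearest $1$ to its west in its row and $(i_0,j)$ the nearest $1$ below it in its column; its neighboring $1$s are the $1$ entries weakly southwest of it such that no other $1$ entry lies both weakly northeast of them and weakly southwest of the $-1$. Consider the $1$s at $(i,j_0)$, $(i_0,j)$ and the neighboring $1$s lying in the rectangle of rows $i..i_0$ and columns $j_0..j$. Replace the south-most of these $1$s by $0$; then moving east to west, for each subsequent one of these $1$s, in column $c$ say, place a new $1$ in the row of the previously replaced $1$ and column $c$, and replace the old $1$ in column $c$ by $0$; finally replace the $-1$ by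 $0$. Repeating until no $-1$ remains yields a permutation matrix (the SW key of $A$), independent of the order of removals. -}

module Defs where

open import Data.Nat using (ℕ)
open import Data.Fin using (Fin; zero; suc; _<_; _≤_; _≟_)
open import Data.Fin.Permutation using (Permutation′; _⟨$⟩ʳ_)
open import Data.Integer using (ℤ; 0ℤ; 1ℤ; -1ℤ; _+_; -_)
open import Data.List using (List; foldr; tabulate)
open import Data.Product using (_×_; Σ; ∃; ∃-syntax; _,_)
open import Data.Sum using (_⊎_)
open import Relation.Nullary using (¬_; yes; no)
open import Relation.Binary.PropositionalEquality using (_≡_; _≢_)
open import Relation.Binary.Construct.Closure.ReflexiveTransitive using (Star)

-- n×n integer matrices; position (i , j) = row i (from the top), column j (from the left)
Matrix : ℕ → Set
Matrix n = Fin n → Fin n → ℤ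

sumFin : ∀ {n} → (Fin n → ℤ) → ℤ
sumFin f = foldr _+_ 0ℤ (tabulate f)

record IsASM {n : ℕ} (A : Matrix n) : Set where
  field
    entries  : ∀ i j → A i j ≡ 0ℤ ⊎ (A i j ≡ 1ℤ ⊎ A i j ≡ -1ℤ)
    rowSum   : ∀ i → sumFin (λ j → A i j) ≡ 1ℤ
    colSum   : ∀ j → sumFin (λ i → A i j) ≡ 1ℤ
    rowAlt   : ∀ i j j′ → j < j′ → A i j ≢ 0ℤ → A i j′ ≢ 0ℤ →
               (∀ k → j < k → k < j′ → A i k ≡ 0ℤ) → A i j′ ≡ - A i j
    colAlt   : ∀ j i i′ → i < i′ → A i j ≢ 0ℤ → A i′ j ≢ 0ℤ →
               (∀ k → i < k → k < i′ → A k j ≡ 0ℤ) → A i′ j ≡ - A i j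

permMatrix : ∀ {n} → Permutation′ n → Matrix n
permMatrix σ i j with (σ ⟨$⟩ʳ i) ≟ j
... | yes _ = 1ℤ
... | no  _ = 0ℤ

-- Pattern containment.  A pattern of size k is given by its one-line
-- notation, as a map Fin k → Fin k.

StrictlyIncreasing : ∀ {k n} → (Fin k → Fin n) → Set
StrictlyIncreasing f = ∀ a b → a < b → f a < f b

Contains : ∀ {n k} → Permutation′ n → (Fin k → Fin k) → Set
Contains {n} {k} σ π =
  Σ (Fin k → Fin n) λ ι → StrictlyIncreasing ι ×
    (∀ a b → ((σ ⟨$⟩ʳ ι a) < (σ ⟨$⟩ʳ ι b) → π a < π b)
           × (π a < π b → (σ ⟨$⟩ʳ ι a) < (σ ⟨$⟩ʳ ι b)))

Avoids : ∀ {n k} → Permutation′ n → (Fin k → Fin k) → Set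
Avoids σ π = ¬ Contains σ π

ClassicallyContains : ∀ {n k} → Matrix n → (Fin k → Fin k) → Set
ClassicallyContains {n} {k} A π =
  Σ (Fin k → Fin n) λ r → Σ (Fin k → Fin n) λ c →
    StrictlyIncreasing r × StrictlyIncreasing c × (∀ a → A (r a) (c (π a)) ≡ 1ℤ)

p312 : Fin 3 → Fin 3
p312 zero = suc (suc zero)
p312 (suc zero) = zero
p312 (suc (suc zero)) = suc zero

p321 : Fin 3 → Fin 3
p321 zero = suc (suc zero)
p321 (suc zero) = suc zero
p321 (suc (suc zero)) = zero

-- SW key process.  Rows increase to the south, columns to the east;
-- (r , c) is weakly southwest of (i , j) iff i ≤ r and c ≤ j.

module _ {n : ℕ} (A : Matrix n) where

  Removable : Fin n → Fin n → Set
  Removable i j = A i j ≡ -1ℤ ×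
    (∀ r c → i ≤ r → c ≤ j → A r c ≡ -1ℤ → r ≡ i × c ≡ j)

  NearestWest : Fin n → Fin n → Fin n → Set
  NearestWest i j j0 = j0 < j × A i j0 ≡ 1ℤ × (∀ c → j0 < c → c < j → A i c ≢ 1ℤ)

  NearestSouth : Fin n → Fin n → Fin n → Set
  NearestSouth i j i0 = i < i0 × A i0 j ≡ 1ℤ × (∀ r → i < r → r < i0 → A r j ≢ 1ℤ)

  Neighbor : Fin n → Fin n → Fin n → Fin n → Set
  Neighbor i j r c = A r c ≡ 1ℤ × i ≤ r × c ≤ j ×
    (∀ r′ c′ → A r′ c′ ≡ 1ℤ → r′ ≤ r → c ≤ c′ → i ≤ r′ → c′ ≤ j → r′ ≡ r × c′ ≡ c)

  -- the set of 1s moved by the removal of the −1 at (i , j)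
  InS : (i j i0 j0 : Fin n) → Fin n → Fin n → Set
  InS i j i0 j0 r c =
    ((r ≡ i × c ≡ j0) ⊎ (r ≡ i0 × c ≡ j)) ⊎
    (Neighbor i j r c × i ≤ r × r ≤ i0 × j0 ≤ c × c ≤ j)

  -- (r , c) receives a new 1: the 1 of the moved set in column c is the one
  -- processed right after the one at (r , c′) (the next one to the east)
  NewOne : (i j i0 j0 : Fin n) → Fin n → Fin n → Set
  NewOne i j i0 j0 r c = ∃[ c′ ] ∃[ r′ ]
    (InS i j i0 j0 r c′ × InS i j i0 j0 r′ c × c < c′ ×
     (∀ r″ c″ → InS i j i0 j0 r″ c″ → ¬ (c < c″ × c″ < c′)))

record Step {n : ℕ} (A B : Matrix n) : Set where
  field
    i j i0 j0  : Fin n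
    removable  : Removable A i j
    west       : NearestWest A i j j0
    south      : NearestSouth A i j i0
    atMinusOne : B i j ≡ 0ℤ
    atOld      : ∀ r c → InS A i j i0 j0 r c → B r c ≡ 0ℤ
    atNew      : ∀ r c → NewOne A i j i0 j0 r c → B r c ≡ 1ℤ
    elsewhere  : ∀ r c → ¬ (r ≡ i × c ≡ j) → ¬ InS A i j i0 j0 r c →
                 ¬ NewOne A i j i0 j0 r c → B r c ≡ A r c

-- σ is the SW key of A: the matrix of σ is obtained from A by a sequence of
-- removal steps (the result is independent of the order of removals)
SWKey : ∀ {n} → Matrix n → Permutation′ n → Set
SWKey A σ = Star Step A (permMatrix σ)

-- Each removal step of the SW key process weakly decreases every north-west corner sum
-- Σ_{x<a, y<b} M x y, so the permutation matrix of the key is dominated corner-wise by A.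
-- In an ASM every row and column prefix sum is 0 or 1, and it is 0 just before a 1. If A has
-- a 321 at rows x1 < x2 < x3 and columns y3 > y2 > y1, the corner of rows < x2 and columns
-- ≤ y2 therefore has sum at most x2 − 1 (enlarge it to the columns < y3, where row x1
-- contributes nothing) and at most y2 − 1 (column y2 contributes nothing above x2; enlarge to
-- the rows < x3, where column y1 contributes nothing). In the key the corner then misses a
-- row x < x2, whose 1 lies right of y2, and two columns ≤ y2, whose 1s lie in rows ≥ x2;
-- these three 1s form a 321 or a 312.

module Submission where

open import Defs
open import Data.Fin.Permutation using (Permutation′; _⟨$⟩ʳ_; _⟨$⟩ˡ_; inverseʳ)
open import Data.Nat as ℕ using (ℕ; zero; suc; z≤n; s≤s; z<s; s<s)
import Data.Nat.Properties as ℕ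
open import Data.Fin using (Fin; zero; suc; toℕ; _<_; _≤_)
import Data.Fin.Properties as Fin
open import Data.Integer as ℤ using (ℤ; +_; -[1+_]; 0ℤ; 1ℤ; -1ℤ; _+_; -_; +≤+; -≤-; -≤+)
import Data.Integer.Properties as ℤ
open import Data.Product using (∃; ∃₂; _×_; _,_; proj₁; proj₂)
open import Data.Sum as ⊎ using (_⊎_; inj₁; inj₂; [_,_]′)
open import Data.Empty using (⊥-elim)
open import Function using (id; _∘_; flip)
open import Relation.Nullary using (¬_; Dec; yes; no; contradiction)
open import Relation.Binary.Definitions using (Tri; tri<; tri≈; tri>)
open import Relation.Nullary.Decidable using (decidable-stable; ¬¬-excluded-middle)
open import Relation.Nullary.Negation.Core using (¬¬-map)
open import Relation.Binary.PropositionalEquality using (_≡_; _≢_; refl; sym; trans; cong; cong₂; subst; subst₂; module ≡-Reasoning)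
open import Relation.Binary.Construct.Closure.ReflexiveTransitive using (Star; ε; _◅_)
open import Algebra.Properties.CommutativeSemigroup ℤ.+-commutativeSemigroup using (interchange)

+-cancelˡ-≤ : ∀ i {j k} → i + j ℤ.≤ i + k → j ℤ.≤ k
+-cancelˡ-≤ i i+j≤i+k = ℤ.≮⇒≥ (λ k<j → ℤ.<⇒≱ (ℤ.+-monoʳ-< i k<j) i+j≤i+k)

+-cancelʳ-≤ : ∀ i {j k} → j + i ℤ.≤ k + i → j ℤ.≤ k
+-cancelʳ-≤ i {j} {k} j+i≤k+i = +-cancelˡ-≤ i (subst₂ ℤ._≤_ (ℤ.+-comm j i) (ℤ.+-comm k i) j+i≤k+i)

+-cancelˡ-< : ∀ i {j k} → i + j ℤ.< i + k → j ℤ.< k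
+-cancelˡ-< i i+j<i+k = ℤ.≰⇒> (λ k≤j → ℤ.<⇒≱ i+j<i+k (ℤ.+-monoʳ-≤ i k≤j))

prefix : ∀ {m} → (Fin m → ℤ) → ℕ → ℤ
prefix {zero}  f b       = 0ℤ
prefix {suc m} f zero    = 0ℤ
prefix {suc m} f (suc b) = f zero + prefix (f ∘ suc) b

prefix-empty : ∀ {m} (f : Fin m → ℤ) → prefix f 0 ≡ 0ℤ
prefix-empty {zero}  f = refl
prefix-empty {suc m} f = refl

prefix-zeros : ∀ {m} b → prefix {m} (λ _ → 0ℤ) b ≡ 0ℤ
prefix-zeros {zero}  b       = refl
prefix-zeros {suc m} zero    = refl
prefix-zeros {suc m} (suc b) = trans (ℤ.+-identityˡ _) (prefix-zeros {m} b)

prefix-+ : ∀ {m} (f g : Fin m → ℤ) b → prefix (λ x → f x + g x) b ≡ prefix f b + prefix g b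
prefix-+ {zero}  f g b       = refl
prefix-+ {suc m} f g zero    = refl
prefix-+ {suc m} f g (suc b) = trans (cong (_+_ (f zero + g zero)) (prefix-+ (f ∘ suc) (g ∘ suc) b))
  (interchange (f zero) (g zero) (prefix (f ∘ suc) b) (prefix (g ∘ suc) b))

prefix-monoˡ-≤ : ∀ {m} {f g : Fin m → ℤ} b → (∀ x → toℕ x ℕ.< b → f x ℤ.≤ g x) → prefix f b ℤ.≤ prefix g b
prefix-monoˡ-≤ {zero}  b       f≤g = ℤ.≤-refl
prefix-monoˡ-≤ {suc m} zero    f≤g = ℤ.≤-refl
prefix-monoˡ-≤ {suc m} (suc b) f≤g =
  ℤ.+-mono-≤ (f≤g zero (s≤s z≤n)) (prefix-monoˡ-≤ b (λ x x<b → f≤g (suc x) (s≤s x<b)))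

prefix-nonneg : ∀ {m} {f : Fin m → ℤ} → (∀ x → 0ℤ ℤ.≤ f x) → ∀ b → 0ℤ ℤ.≤ prefix f b
prefix-nonneg {m} {f} 0≤f b = subst (ℤ._≤ prefix f b) (prefix-zeros {m} b) (prefix-monoˡ-≤ b (λ x _ → 0≤f x))

prefix-monoʳ-≤ : ∀ {m} {f : Fin m → ℤ} → (∀ x → 0ℤ ℤ.≤ f x) → ∀ {b b′} → b ℕ.≤ b′ → prefix f b ℤ.≤ prefix f b′
prefix-monoʳ-≤ {zero}  0≤f _         = ℤ.≤-refl
prefix-monoʳ-≤ {suc m} 0≤f {b′ = b′} z≤n = prefix-nonneg 0≤f b′
prefix-monoʳ-≤ {suc m} {f} 0≤f (s≤s b≤b′) = ℤ.+-monoʳ-≤ (f zero) (prefix-monoʳ-≤ (0≤f ∘ suc) b≤b′)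

prefix-suc : ∀ {m} (f : Fin m → ℤ) x → prefix f (suc (toℕ x)) ≡ prefix f (toℕ x) + f x
prefix-suc {suc m} f zero    = trans (cong (_+_ (f zero)) (prefix-empty (f ∘ suc))) (ℤ.+-comm (f zero) 0ℤ)
prefix-suc {suc m} f (suc x) = trans (cong (_+_ (f zero)) (prefix-suc (f ∘ suc) x))
  (sym (ℤ.+-assoc (f zero) (prefix (f ∘ suc) (toℕ x)) (f (suc x))))

prefix-sumFin : ∀ {m} (f : Fin m → ℤ) → prefix f m ≡ sumFin f
prefix-sumFin {zero}  f = refl
prefix-sumFin {suc m} f = cong (_+_ (f zero)) (prefix-sumFin (f ∘ suc))

term≤prefix : ∀ {m} {f : Fin m → ℤ} → (∀ x → 0ℤ ℤ.≤ f x) → ∀ {x b} → toℕ x ℕ.< b → f x ℤ.≤ prefix f b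
term≤prefix {f = f} 0≤f {zero}  {suc b} _ = ℤ.i≤i+j (f zero) _ {{ℤ.nonNegative (prefix-nonneg (0≤f ∘ suc) b)}}
term≤prefix {f = f} 0≤f {suc x} {suc b} (s≤s x<b) =
  ℤ.≤-trans (term≤prefix (0≤f ∘ suc) x<b) (ℤ.i≤j+i _ (f zero) {{ℤ.nonNegative (0≤f zero)}})

δ : ∀ {m} → Fin m → Fin m → ℤ
δ zero    zero    = 1ℤ
δ zero    (suc _) = 0ℤ
δ (suc _) zero    = 0ℤ
δ (suc p) (suc x) = δ p x

δ-diag : ∀ {m} (p : Fin m) → δ p p ≡ 1ℤ
δ-diag zero    = refl
δ-diag (suc p) = δ-diag p

δ-off : ∀ {m} {p x : Fin m} → x ≢ p → δ p x ≡ 0ℤ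
δ-off {p = zero}  {zero}  x≢p = contradiction refl x≢p
δ-off {p = zero}  {suc x} _   = refl
δ-off {p = suc p} {zero}  _   = refl
δ-off {p = suc p} {suc x} x≢p = δ-off (x≢p ∘ cong suc)

δ-nonneg : ∀ {m} (p x : Fin m) → 0ℤ ℤ.≤ δ p x
δ-nonneg zero    zero    = +≤+ z≤n
δ-nonneg zero    (suc _) = +≤+ z≤n
δ-nonneg (suc _) zero    = +≤+ z≤n
δ-nonneg (suc p) (suc x) = δ-nonneg p x

prefix-δ : ∀ {m} (p : Fin m) {b} → toℕ p ℕ.< b → prefix (δ p) b ≡ 1ℤ
prefix-δ {suc m} zero    {suc b} _         = cong (_+_ 1ℤ) (prefix-zeros {m} b)
prefix-δ {suc m} (suc p) {suc b} (s≤s p<b) = trans (ℤ.+-identityˡ _) (prefix-δ p p<b)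

prefix-δ-outside : ∀ {m} (p : Fin m) {b} → b ℕ.≤ toℕ p → prefix (δ p) b ≡ 0ℤ
prefix-δ-outside p       {zero}  _         = prefix-empty (δ p)
prefix-δ-outside (suc p) {suc b} (s≤s b≤p) = trans (ℤ.+-identityˡ _) (prefix-δ-outside p b≤p)

prefix-δ-mono : ∀ {m} (p q : Fin m) b → (toℕ q ℕ.< b → toℕ p ℕ.< b) → prefix (δ q) b ℤ.≤ prefix (δ p) b
prefix-δ-mono p q b q<b⇒p<b with toℕ q ℕ.<? b
... | yes q<b = ℤ.≤-reflexive (trans (prefix-δ q q<b) (sym (prefix-δ p (q<b⇒p<b q<b))))
... | no  q≮b = subst (ℤ._≤ prefix (δ p) b) (sym (prefix-δ-outside q (ℕ.≮⇒≥ q≮b))) (prefix-nonneg (δ-nonneg p) b)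

prefix-≤-transfer : ∀ {m} {f g : Fin m → ℤ} (p q : Fin m) →
  f p + 1ℤ ℤ.≤ g p → f q ℤ.≤ g q + 1ℤ → (∀ y → y ≢ p → y ≢ q → f y ℤ.≤ g y) →
  ∀ b → (toℕ q ℕ.< b → toℕ p ℕ.< b) → prefix f b ℤ.≤ prefix g b
prefix-≤-transfer {f = f} {g} p q at-p at-q elsewhere b q<b⇒p<b =
  +-cancelʳ-≤ (prefix (δ p) b) (begin
    prefix f b + prefix (δ p) b          ≡⟨ prefix-+ f (δ p) b ⟨
    prefix (λ y → f y + δ p y) b         ≤⟨ prefix-monoˡ-≤ b (λ y _ → pointwise y) ⟩
    prefix (λ y → g y + δ q y) b         ≡⟨ prefix-+ g (δ q) b ⟩
    prefix g b + prefix (δ q) b          ≤⟨ ℤ.+-monoʳ-≤ (prefix g b) (prefix-δ-mono p q b q<b⇒p<b) ⟩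
    prefix g b + prefix (δ p) b          ∎)
  where
  open ℤ.≤-Reasoning
  pointwise : ∀ y → f y + δ p y ℤ.≤ g y + δ q y
  pointwise y with y Fin.≟ p | y Fin.≟ q
  ... | yes refl | _        = ℤ.≤-trans (subst (λ d → f y + d ℤ.≤ g y) (sym (δ-diag y)) at-p)
                                         (ℤ.i≤i+j (g y) (δ q y) {{ℤ.nonNegative (δ-nonneg q y)}})
  ... | no y≢p   | yes refl = subst₂ (λ d e → f y + d ℤ.≤ g y + e) (sym (δ-off y≢p)) (sym (δ-diag y))
                                     (ℤ.≤-trans (ℤ.≤-reflexive (ℤ.+-identityʳ (f y))) at-q)
  ... | no y≢p   | no y≢q   = subst₂ (λ d e → f y + d ℤ.≤ g y + e) (sym (δ-off y≢p)) (sym (δ-off y≢q))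
                                     (ℤ.+-monoˡ-≤ 0ℤ (elsewhere y y≢p y≢q))

prefix≤length : ∀ {m} {f : Fin m → ℤ} → (∀ x → f x ℤ.≤ 1ℤ) → ∀ b → prefix f b ℤ.≤ + b
prefix≤length {zero}  f≤1 b       = +≤+ z≤n
prefix≤length {suc m} f≤1 zero    = ℤ.≤-refl
prefix≤length {suc m} f≤1 (suc b) = ℤ.+-mono-≤ (f≤1 zero) (prefix≤length (f≤1 ∘ suc) b)

prefix<length : ∀ {m} {f : Fin m → ℤ} → (∀ x → f x ℤ.≤ 1ℤ) →
                ∀ {x b} → f x ℤ.≤ 0ℤ → toℕ x ℕ.< b → prefix f b ℤ.< + b
prefix<length {suc m} f≤1 {zero}  {suc b} fx≤0 _ =
  ℤ.+-mono-<-≤ (ℤ.≤-<-trans fx≤0 (ℤ.+<+ (s≤s z≤n))) (prefix≤length (f≤1 ∘ suc) b)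
prefix<length {suc m} f≤1 {suc x} {suc b} fx≤0 (s≤s x<b) =
  ℤ.+-mono-≤-< (f≤1 zero) (prefix<length (f≤1 ∘ suc) fx≤0 x<b)

≰0⇒1≤ : ∀ {i} → ¬ (i ℤ.≤ 0ℤ) → 1ℤ ℤ.≤ i
≰0⇒1≤ i≰0 = ℤ.i<j⇒suc[i]≤j (ℤ.≰⇒> i≰0)

prefix<length⇒∃≤0 : ∀ {m} (f : Fin m → ℤ) {b} → b ℕ.≤ m → prefix f b ℤ.< + b →
                    ∃ λ x → toℕ x ℕ.< b × f x ℤ.≤ 0ℤ
prefix<length⇒∃≤0 {zero}  f z≤n 0<0 = contradiction 0<0 (ℤ.<-irrefl refl)
prefix<length⇒∃≤0 {suc m} f z≤n 0<0 = contradiction 0<0 (ℤ.<-irrefl refl)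
prefix<length⇒∃≤0 {suc m} f {suc b} (s≤s b≤m) short with f zero ℤ.≤? 0ℤ
... | yes f0≤0 = zero , s≤s z≤n , f0≤0
... | no  f0≰0 = let x , x<b , fx≤0 = prefix<length⇒∃≤0 (f ∘ suc) b≤m tail-short in suc x , s≤s x<b , fx≤0
  where
  tail-short : prefix (f ∘ suc) b ℤ.< + b
  tail-short = +-cancelˡ-< 1ℤ (ℤ.≤-<-trans (ℤ.+-monoˡ-≤ (prefix (f ∘ suc) b) (≰0⇒1≤ f0≰0)) short)

1+prefix<length⇒∃₂≤0 : ∀ {m} {f : Fin m → ℤ} → (∀ x → 0ℤ ℤ.≤ f x) → ∀ {b} → b ℕ.≤ m →
                       1ℤ + prefix f b ℤ.< + b →
                       ∃₂ λ x y → x < y × toℕ y ℕ.< b × f x ℤ.≤ 0ℤ × f y ℤ.≤ 0ℤ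
1+prefix<length⇒∃₂≤0 {zero}  0≤f z≤n (ℤ.+<+ ())
1+prefix<length⇒∃₂≤0 {suc m} 0≤f z≤n (ℤ.+<+ ())
1+prefix<length⇒∃₂≤0 {suc m} {f} 0≤f {suc b} (s≤s b≤m) short with f zero ℤ.≤? 0ℤ
... | yes f0≤0 =
  let y , y<b , fy≤0 = prefix<length⇒∃≤0 (f ∘ suc) b≤m tail-short
  in zero , suc y , s≤s z≤n , s≤s y<b , f0≤0 , fy≤0
  where
  tail-short : prefix (f ∘ suc) b ℤ.< + b
  tail-short = +-cancelˡ-< 1ℤ (ℤ.≤-<-trans (ℤ.+-monoʳ-≤ 1ℤ (ℤ.i≤j+i _ (f zero) {{ℤ.nonNegative (0≤f zero)}})) short)
... | no  f0≰0 =
  let x , y , x<y , y<b , fx≤0 , fy≤0 = 1+prefix<length⇒∃₂≤0 (0≤f ∘ suc) b≤m tail-short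
  in suc x , suc y , s≤s x<y , s≤s y<b , fx≤0 , fy≤0
  where
  tail-short : 1ℤ + prefix (f ∘ suc) b ℤ.< + b
  tail-short = +-cancelˡ-< 1ℤ (ℤ.≤-<-trans (ℤ.+-monoʳ-≤ 1ℤ (ℤ.+-monoˡ-≤ (prefix (f ∘ suc) b) (≰0⇒1≤ f0≰0))) short)

cornerSum : ∀ {m k} → (Fin m → Fin k → ℤ) → ℕ → ℕ → ℤ
cornerSum M a b = prefix (λ x → prefix (M x) b) a

cornerSum-flip : ∀ {m k} (M : Fin m → Fin k → ℤ) a b → cornerSum M a b ≡ cornerSum (flip M) b a
cornerSum-flip {zero}  {k} M a       b = sym (prefix-zeros {k} b)
cornerSum-flip {suc m} {k} M zero    b = sym (prefix-zeros {k} b)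
cornerSum-flip {suc m} {k} M (suc a) b = begin
  prefix (M zero) b + cornerSum (M ∘ suc) a b  ≡⟨ cong (_+_ (prefix (M zero) b)) (cornerSum-flip (M ∘ suc) a b) ⟩
  prefix (M zero) b + prefix lower-column b    ≡⟨ prefix-+ (M zero) lower-column b ⟨
  prefix (λ y → M zero y + lower-column y) b   ∎
  where
  open ≡-Reasoning
  lower-column : Fin k → ℤ
  lower-column y = prefix (λ x → M (suc x) y) a

Bit : ℤ → Set
Bit v = v ≡ 0ℤ ⊎ v ≡ 1ℤ

bit-nonneg : ∀ {v} → Bit v → 0ℤ ℤ.≤ v
bit-nonneg (inj₁ refl) = +≤+ z≤n
bit-nonneg (inj₂ refl) = +≤+ z≤n

bit≤1 : ∀ {v} → Bit v → v ℤ.≤ 1ℤ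
bit≤1 (inj₁ refl) = +≤+ z≤n
bit≤1 (inj₂ refl) = ℤ.≤-refl

prefix-before-1 : ∀ {m} (f : Fin m → ℤ) → (∀ b → Bit (prefix f b)) → ∀ {x} → f x ≡ 1ℤ → prefix f (toℕ x) ≡ 0ℤ
prefix-before-1 f bits {x} fx≡1 with bits (toℕ x)
... | inj₁ p≡0 = p≡0
... | inj₂ p≡1 = contradiction (subst Bit (trans (prefix-suc f x) (cong₂ _+_ p≡1 fx≡1)) (bits (suc (toℕ x))))
                               λ { (inj₁ ()) ; (inj₂ ()) }

Alternating : ∀ {m} → (Fin m → ℤ) → Set
Alternating f = ∀ x x′ → x < x′ → f x ≢ 0ℤ → f x′ ≢ 0ℤ → (∀ y → x < y → y < x′ → f y ≡ 0ℤ) → f x′ ≡ - f x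

FirstNonzeroIs : ∀ {m} → ℤ → (Fin m → ℤ) → Set
FirstNonzeroIs s f = ∀ x → f x ≢ 0ℤ → (∀ y → y < x → f y ≡ 0ℤ) → f x ≡ s

alternating-tail : ∀ {m} {f : Fin (suc m) → ℤ} → Alternating f → Alternating (f ∘ suc)
alternating-tail alt x x′ x<x′ fx≢0 fx′≢0 between = alt (suc x) (suc x′) (s≤s x<x′) fx≢0 fx′≢0 λ where
  (suc y) (s≤s x<y) (s≤s y<x′) → between y x<y y<x′

first-nonzero-unique : ∀ {m} {f : Fin m → ℤ} x → f x ≢ 0ℤ → (∀ y → y < x → f y ≡ 0ℤ) → FirstNonzeroIs (f x) f
first-nonzero-unique x fx≢0 before x′ fx′≢0 before′ with Fin.<-cmp x′ x
... | tri< x′<x _ _ = contradiction (before x′ x′<x) fx′≢0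
... | tri≈ _ refl _ = refl
... | tri> _ _ x<x′ = contradiction (before′ x x<x′) fx≢0

alternating-prefix : ∀ {m} {f : Fin m → ℤ} {s} → Alternating f → FirstNonzeroIs s f →
                     ∀ b → prefix f b ≡ 0ℤ ⊎ prefix f b ≡ s
alternating-prefix {zero}  alt first b       = inj₁ refl
alternating-prefix {suc m} alt first zero    = inj₁ refl
alternating-prefix {suc m} {f} {s} alt first (suc b) with f zero ℤ.≟ 0ℤ
... | yes f0≡0 = ⊎.map (shift refl) (shift (ℤ.+-identityˡ s)) (alternating-prefix (alternating-tail alt) first′ b)
  where
  shift : ∀ {t u} → 0ℤ + t ≡ u → prefix (f ∘ suc) b ≡ t → prefix f (suc b) ≡ u
  shift 0+t≡u tail≡t = trans (cong₂ _+_ f0≡0 tail≡t) 0+t≡u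
  first′ : FirstNonzeroIs s (f ∘ suc)
  first′ x nz before = first (suc x) nz λ where
    zero    _         → f0≡0
    (suc y) (s≤s y<x) → before y y<x
... | no  f0≢0 = [ (λ t≡0 → inj₂ (trans (cong₂ _+_ f0≡s t≡0) (ℤ.+-identityʳ s)))
                          , (λ t≡-s → inj₁ (trans (cong₂ _+_ f0≡s t≡-s) (ℤ.+-inverseʳ s))) ]′
                   (alternating-prefix (alternating-tail alt) first′ b)
  where
  f0≡s : f zero ≡ s
  f0≡s = first zero f0≢0 λ _ ()
  first′ : FirstNonzeroIs (- s) (f ∘ suc)
  first′ x nz before = trans (alt zero (suc x) (s≤s z≤n) f0≢0 nz between) (cong -_ f0≡s)
    where
    between : ∀ (y : Fin (suc m)) → zero {m} < y → y < suc x → f y ≡ 0ℤ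
    between (suc y) _ (s≤s y<x) = before y y<x

alternating-prefix-bit : ∀ {m} {f : Fin m → ℤ} → Alternating f → sumFin f ≡ 1ℤ → ∀ b → Bit (prefix f b)
alternating-prefix-bit {m} {f} alt sum≡1 = alternating-prefix alt first-nonzero-is-1
  where
  first-nonzero-is-1 : FirstNonzeroIs 1ℤ f
  first-nonzero-is-1 x fx≢0 before
    with alternating-prefix alt (first-nonzero-unique x fx≢0 before) m
  ... | inj₁ total≡0  = contradiction (trans (sym total≡0) (trans (prefix-sumFin f) sum≡1)) λ ()
  ... | inj₂ total≡fx = trans (sym total≡fx) (trans (prefix-sumFin f) sum≡1)

IsASM-flip : ∀ {n} {A : Matrix n} → IsASM A → IsASM (flip A)
IsASM-flip asm = record
  { entries = flip entries ; rowSum = colSum ; colSum = rowSum ; rowAlt = colAlt ; colAlt = rowAlt }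
  where open IsASM asm

module _ {n} {A : Matrix n} (asm : IsASM A) where

  rowPrefix-bit : ∀ x b → Bit (prefix (A x) b)
  rowPrefix-bit x = alternating-prefix-bit (IsASM.rowAlt asm x) (IsASM.rowSum asm x)

  colPrefix-bit : ∀ y a → Bit (prefix (flip A y) a)
  colPrefix-bit y = alternating-prefix-bit (IsASM.colAlt asm y) (IsASM.colSum asm y)

  cornerSum-monoʳ-≤ : ∀ a {b b′} → b ℕ.≤ b′ → cornerSum A a b ℤ.≤ cornerSum A a b′
  cornerSum-monoʳ-≤ a {b} {b′} b≤b′ = subst₂ ℤ._≤_ (sym (cornerSum-flip A a b)) (sym (cornerSum-flip A a b′))
    (prefix-monoʳ-≤ (λ y → bit-nonneg (colPrefix-bit y a)) b≤b′)

  cornerSum<height : ∀ {r c a b} → A r c ≡ 1ℤ → toℕ r ℕ.< a → b ℕ.≤ toℕ c → cornerSum A a b ℤ.< + a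
  cornerSum<height {r} {c} {a} Arc≡1 r<a b≤c = ℤ.≤-<-trans (cornerSum-monoʳ-≤ a b≤c)
    (prefix<length (λ x → bit≤1 (rowPrefix-bit x (toℕ c)))
                   (ℤ.≤-reflexive (prefix-before-1 (A r) (rowPrefix-bit r) Arc≡1)) r<a)

  cornerSum-widen-at-1 : ∀ {r c} → A r c ≡ 1ℤ →
                         cornerSum A (toℕ r) (suc (toℕ c)) ≡ cornerSum A (toℕ r) (toℕ c)
  cornerSum-widen-at-1 {r} {c} Arc≡1 = begin
    cornerSum A (toℕ r) (suc (toℕ c))         ≡⟨ cornerSum-flip A (toℕ r) _ ⟩
    cornerSum (flip A) (suc (toℕ c)) (toℕ r)  ≡⟨ prefix-suc _ c ⟩
    narrower + prefix (flip A c) (toℕ r)      ≡⟨ cong (_+_ narrower) (prefix-before-1 (flip A c) (colPrefix-bit c) Arc≡1) ⟩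
    narrower + 0ℤ                             ≡⟨ ℤ.+-identityʳ narrower ⟩
    narrower                                  ≡⟨ cornerSum-flip A (toℕ r) (toℕ c) ⟨
    cornerSum A (toℕ r) (toℕ c)               ∎
    where
    open ≡-Reasoning
    narrower : ℤ
    narrower = cornerSum (flip A) (toℕ c) (toℕ r)

-- The matrices met during the SW key process are not shown to be ASMs; this invariant is all
-- that the analysis of a step needs.
Entries≥-1 : ∀ {n} → Matrix n → Set
Entries≥-1 M = ∀ r c → -1ℤ ℤ.≤ M r c

IsASM⇒Entries≥-1 : ∀ {n} {A : Matrix n} → IsASM A → Entries≥-1 A
IsASM⇒Entries≥-1 asm r c with IsASM.entries asm r c
... | inj₁ Arc≡0        = subst (-1ℤ ℤ.≤_) (sym Arc≡0) -≤+
... | inj₂ (inj₁ Arc≡1) = subst (-1ℤ ℤ.≤_) (sym Arc≡1) -≤+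
... | inj₂ (inj₂ Arc≡-1) = ℤ.≤-reflexive (sym Arc≡-1)

≥-1∧≢-1⇒≥0 : ∀ {v} → -1ℤ ℤ.≤ v → v ≢ -1ℤ → 0ℤ ℤ.≤ v
≥-1∧≢-1⇒≥0 {+ _}           _        _     = +≤+ z≤n
≥-1∧≢-1⇒≥0 { -[1+ 0 ]}     _        v≢-1 = contradiction refl v≢-1
≥-1∧≢-1⇒≥0 { -[1+ suc _ ]} (-≤- ()) _

-- The sets InS and NewOne of a removal step are not decidable as stated, so case analyses on
-- them go through double negation; this is sound because every goal that needs one is decidable.
caseOn : ∀ (P : Set) {Q : Set} → Dec Q → (Dec P → Q) → Q
caseOn P Q? byCases = decidable-stable Q? (¬¬-map byCases ¬¬-excluded-middle)

module StepAnalysis {n} {A B : Matrix n} (step : Step A B) (A≥-1 : Entries≥-1 A) where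
  open Step step

  Moved : Fin n → Fin n → Set
  Moved = InS A i j i0 j0

  New : Fin n → Fin n → Set
  New = NewOne A i j i0 j0

  1≢-1 : ∀ {v} → v ≡ 1ℤ → v ≢ -1ℤ
  1≢-1 refl ()

  west-neighbor : Neighbor A i j i j0
  west-neighbor = proj₁ (proj₂ west) , Fin.≤-refl , ℕ.<⇒≤ (proj₁ west) , nearest
    where
    nearest : ∀ r c → A r c ≡ 1ℤ → r ≤ i → j0 ≤ c → i ≤ r → c ≤ j → r ≡ i × c ≡ j0
    nearest r c Arc≡1 r≤i j0≤c i≤r c≤j with Fin.≤-antisym r≤i i≤r | c Fin.≟ j0 | c Fin.≟ j
    ... | refl | yes c≡j0 | _        = refl , c≡j0
    ... | refl | no  _    | yes refl = contradiction (proj₁ removable) (1≢-1 Arc≡1)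
    ... | refl | no  c≢j0 | no  c≢j  =
      contradiction Arc≡1 (proj₂ (proj₂ west) c (Fin.≤∧≢⇒< j0≤c (c≢j0 ∘ sym)) (Fin.≤∧≢⇒< c≤j c≢j))

  south-neighbor : Neighbor A i j i0 j
  south-neighbor = proj₁ (proj₂ south) , ℕ.<⇒≤ (proj₁ south) , Fin.≤-refl , nearest
    where
    nearest : ∀ r c → A r c ≡ 1ℤ → r ≤ i0 → j ≤ c → i ≤ r → c ≤ j → r ≡ i0 × c ≡ j
    nearest r c Arc≡1 r≤i0 j≤c i≤r c≤j with Fin.≤-antisym c≤j j≤c | r Fin.≟ i0 | r Fin.≟ i
    ... | refl | yes r≡i0 | _        = r≡i0 , refl
    ... | refl | no  _    | yes refl = contradiction (proj₁ removable) (1≢-1 Arc≡1)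
    ... | refl | no  r≢i0 | no  r≢i  =
      contradiction Arc≡1 (proj₂ (proj₂ south) r (Fin.≤∧≢⇒< i≤r (r≢i ∘ sym)) (Fin.≤∧≢⇒< r≤i0 r≢i0))

  moved-neighbor : ∀ {r c} → Moved r c → Neighbor A i j r c
  moved-neighbor (inj₁ (inj₁ (refl , refl))) = west-neighbor
  moved-neighbor (inj₁ (inj₂ (refl , refl))) = south-neighbor
  moved-neighbor (inj₂ (neighbor , _))       = neighbor

  moved-west : Moved i j0
  moved-west = inj₁ (inj₁ (refl , refl))

  moved-one : ∀ {r c} → Moved r c → A r c ≡ 1ℤ
  moved-one = proj₁ ∘ moved-neighbor

  moved-below-i : ∀ {r c} → Moved r c → i ≤ r
  moved-below-i = proj₁ ∘ proj₂ ∘ moved-neighbor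

  moved-left-of-j : ∀ {r c} → Moved r c → c ≤ j
  moved-left-of-j = proj₁ ∘ proj₂ ∘ proj₂ ∘ moved-neighbor

  moved-antichain : ∀ {r c r′ c′} → Moved r c → Moved r′ c′ → c ≤ c′ → r′ ≤ r → r′ ≡ r × c′ ≡ c
  moved-antichain m m′ c≤c′ r′≤r =
    proj₂ (proj₂ (proj₂ (moved-neighbor m))) _ _ (moved-one m′) r′≤r c≤c′ (moved-below-i m′) (moved-left-of-j m′)

  moved-row-unique : ∀ {r c c′} → Moved r c → Moved r c′ → c ≡ c′
  moved-row-unique {c = c} {c′} m m′ with Fin.≤-total c c′
  ... | inj₁ c≤c′ = sym (proj₂ (moved-antichain m m′ c≤c′ Fin.≤-refl))
  ... | inj₂ c′≤c = proj₂ (moved-antichain m′ m c′≤c Fin.≤-refl)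

  moved-col-unique : ∀ {r r′ c} → Moved r c → Moved r′ c → r ≡ r′
  moved-col-unique {r} {r′} m m′ with Fin.≤-total r r′
  ... | inj₁ r≤r′ = proj₁ (moved-antichain m′ m Fin.≤-refl r≤r′)
  ... | inj₂ r′≤r = sym (proj₁ (moved-antichain m m′ Fin.≤-refl r′≤r))

  moved-chain : ∀ {r c r′ c′} → Moved r c → Moved r′ c′ → c < c′ → r < r′
  moved-chain {r} {r′ = r′} m m′ c<c′ with toℕ r ℕ.<? toℕ r′
  ... | yes r<r′ = r<r′
  ... | no  r≮r′ = contradiction (proj₂ (moved-antichain m m′ (ℕ.<⇒≤ c<c′) (ℕ.≮⇒≥ r≮r′))) (Fin.<⇒≢ c<c′ ∘ sym)

  moved-right-of-j0 : ∀ {r c} → Moved r c → j0 ≤ c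
  moved-right-of-j0 {c = c} m with toℕ c ℕ.<? toℕ j0
  ... | yes c<j0 = contradiction (proj₂ (moved-antichain m moved-west (ℕ.<⇒≤ c<j0) (moved-below-i m)))
                                 (Fin.<⇒≢ c<j0 ∘ sym)
  ... | no  c≮j0 = ℕ.≮⇒≥ c≮j0

  new-row-unique : ∀ {r c c₂} → New r c → New r c₂ → c ≡ c₂
  new-row-unique {c = c} {c₂} (c′ , r′ , m , m′ , c<c′ , free) (d′ , s′ , k , k′ , c₂<d′ , free₂)
    with moved-row-unique m k
  ... | refl with Fin.<-cmp c c₂
  ...   | tri< c<c₂ _ _ = contradiction (c<c₂ , c₂<d′) (free s′ c₂ k′)
  ...   | tri≈ _ c≡c₂ _ = c≡c₂
  ...   | tri> _ _ c₂<c = contradiction (c₂<c , c<c′) (free₂ r′ c m′)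

  new-col-unique : ∀ {r r₂ c} → New r c → New r₂ c → r ≡ r₂
  new-col-unique {r} {r₂} (c′ , r′ , m , m′ , c<c′ , free) (d′ , s′ , k , k′ , c<d′ , free₂)
    with Fin.<-cmp c′ d′
  ... | tri< c′<d′ _ _ = contradiction (c<c′ , c′<d′) (free₂ r c′ m)
  ... | tri≈ _ refl _  = moved-col-unique m k
  ... | tri> _ _ d′<c′ = contradiction (c<d′ , d′<c′) (free r₂ d′ k)

  new-not-in-row-i : ∀ {c} → ¬ New i c
  new-not-in-row-i (c′ , r′ , m , m′ , c<c′ , _) with moved-row-unique m moved-west
  ... | refl = ℕ.<-irrefl refl (ℕ.<-≤-trans c<c′ (moved-right-of-j0 m′))

  new-nonneg : ∀ {r c} → New r c → 0ℤ ℤ.≤ A r c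
  new-nonneg {r} {c} (c′ , r′ , m , m′ , c<c′ , _) =
    ≥-1∧≢-1⇒≥0 (A≥-1 r c) λ Arc≡-1 → Fin.<⇒≢ c<j (proj₂ (proj₂ removable r c (moved-below-i m) (ℕ.<⇒≤ c<j) Arc≡-1))
    where
    c<j : c < j
    c<j = ℕ.<-≤-trans c<c′ (moved-left-of-j m)

  lost-at-moved : ∀ {r c} → Moved r c → B r c + 1ℤ ℤ.≤ A r c
  lost-at-moved {r} {c} m = subst₂ (λ u v → u + 1ℤ ℤ.≤ v) (sym (atOld r c m)) (sym (moved-one m)) ℤ.≤-refl

  gained-at-new : ∀ {r c} → New r c → B r c ℤ.≤ A r c + 1ℤ
  gained-at-new {r} {c} nw = subst (ℤ._≤ A r c + 1ℤ) (sym (atNew r c nw)) (ℤ.+-monoˡ-≤ 1ℤ (new-nonneg nw))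

  gained-at-minus : B i j ℤ.≤ A i j + 1ℤ
  gained-at-minus = subst₂ (λ u v → u ℤ.≤ v + 1ℤ) (sym atMinusOne) (sym (proj₁ removable)) ℤ.≤-refl

  B≤A-off-new : ∀ {r c} → ¬ (r ≡ i × c ≡ j) → ¬ New r c → B r c ℤ.≤ A r c
  B≤A-off-new {r} {c} not-ij not-new = caseOn (Moved r c) (B r c ℤ.≤? A r c) λ where
    (yes m)     → ℤ.≤-trans (ℤ.i≤i+j (B r c) 1ℤ) (lost-at-moved m)
    (no  not-m) → ℤ.≤-reflexive (elsewhere r c not-ij not-m not-new)

  Entries≥-1-step : Entries≥-1 B
  Entries≥-1-step r c = caseOn (r ≡ i × c ≡ j) (-1ℤ ℤ.≤? B r c) λ where
    (yes (refl , refl)) → subst (-1ℤ ℤ.≤_) (sym atMinusOne) -≤+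
    (no  not-ij)        → caseOn (New r c) (-1ℤ ℤ.≤? B r c) λ where
      (yes nw)     → subst (-1ℤ ℤ.≤_) (sym (atNew r c nw)) -≤+
      (no  not-nw) → caseOn (Moved r c) (-1ℤ ℤ.≤? B r c) λ where
        (yes m)     → subst (-1ℤ ℤ.≤_) (sym (atOld r c m)) -≤+
        (no  not-m) → subst (-1ℤ ℤ.≤_) (sym (elsewhere r c not-ij not-m not-nw)) (A≥-1 r c)

  row-prefix≤ : ∀ {b} → toℕ j ℕ.< b → ∀ x → prefix (B x) b ℤ.≤ prefix (A x) b
  row-prefix≤ {b} j<b x with x Fin.≟ i
  ... | yes refl = prefix-≤-transfer j0 j (lost-at-moved moved-west) gained-at-minus
                     (λ y _ y≢j → B≤A-off-new (y≢j ∘ proj₂) new-not-in-row-i)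
                     b (λ _ → ℕ.<-trans (proj₁ west) j<b)
  ... | no  x≢i  = caseOn (∃ (New x)) (_ ℤ.≤? _) λ where
    (yes (cp , cp-new@(cs , _ , cs-moved , _ , _ , _))) →
      prefix-≤-transfer cs cp (lost-at-moved cs-moved) (gained-at-new cp-new)
        (λ y _ y≢cp → B≤A-off-new (x≢i ∘ proj₁) (y≢cp ∘ flip new-row-unique cp-new))
        b (λ _ → ℕ.≤-<-trans (moved-left-of-j cs-moved) j<b)
    (no no-new) → prefix-monoˡ-≤ b (λ y _ → B≤A-off-new (x≢i ∘ proj₁) (no-new ∘ (y ,_)))

  col-prefix≤ : ∀ {y} → y ≢ j → ∀ a → prefix (flip B y) a ℤ.≤ prefix (flip A y) a
  col-prefix≤ {y} y≢j a = caseOn (∃ λ r → New r y) (_ ℤ.≤? _) λ where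
    (yes (rn , rn-new@(c′ , rk , rn-moved , rk-moved , y<c′ , _))) →
      prefix-≤-transfer rk rn (lost-at-moved rk-moved) (gained-at-new rn-new)
        (λ x _ x≢rn → B≤A-off-new (y≢j ∘ proj₂) (x≢rn ∘ flip new-col-unique rn-new))
        a (ℕ.<-trans (moved-chain rk-moved rn-moved y<c′))
    (no no-new) → prefix-monoˡ-≤ a (λ x _ → B≤A-off-new (y≢j ∘ proj₂) (no-new ∘ (x ,_)))

  -- If column j lies in the corner, compare row by row: row i loses its west 1 and its −1, and
  -- any other row trades a 1 for one further west. Otherwise compare column by column: a column
  -- other than j trades a 1 for one further south.
  cornerSum≤ : ∀ a b → cornerSum B a b ℤ.≤ cornerSum A a b
  cornerSum≤ a b with toℕ j ℕ.<? b
  ... | yes j<b = prefix-monoˡ-≤ a (λ x _ → row-prefix≤ j<b x)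
  ... | no  j≮b = subst₂ ℤ._≤_ (sym (cornerSum-flip B a b)) (sym (cornerSum-flip A a b))
                    (prefix-monoˡ-≤ b (λ y y<b → col-prefix≤ {y} (λ { refl → j≮b y<b }) a))

cornerSum-steps : ∀ {n} {A M : Matrix n} → Star Step A M → Entries≥-1 A →
                  ∀ a b → cornerSum M a b ℤ.≤ cornerSum A a b
cornerSum-steps ε              A≥-1 a b = ℤ.≤-refl
cornerSum-steps (step ◅ steps) A≥-1 a b = ℤ.≤-trans (cornerSum-steps steps Entries≥-1-step a b) (cornerSum≤ a b)
  where open StepAnalysis step A≥-1

pattern 0F = zero
pattern 1F = suc zero
pattern 2F = suc (suc zero)

triple : ∀ {n} → Fin n → Fin n → Fin n → Fin 3 → Fin n
triple x y z 0F = x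
triple x y z 1F = y
triple x y z 2F = z

triple-increasing : ∀ {n} {x y z : Fin n} → x < y → y < z → StrictlyIncreasing (triple x y z)
triple-increasing x<y y<z 0F 1F _ = x<y
triple-increasing x<y y<z 0F 2F _ = Fin.<-trans x<y y<z
triple-increasing x<y y<z 1F 2F _ = y<z
triple-increasing x<y y<z 0F 0F ()
triple-increasing x<y y<z 1F 0F ()
triple-increasing x<y y<z 1F 1F (s<s ())
triple-increasing x<y y<z 2F 0F ()
triple-increasing x<y y<z 2F 1F (s<s ())
triple-increasing x<y y<z 2F 2F (s<s (s<s ()))

StrictlyIncreasing⇒reflects : ∀ {k n} {g : Fin k → Fin n} → StrictlyIncreasing g → ∀ {a b} → g a < g b → a < b
StrictlyIncreasing⇒reflects {g = g} g↑ {a} {b} ga<gb with Fin.<-cmp a b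
... | tri< a<b _ _ = a<b
... | tri≈ _ refl _ = contradiction ga<gb (Fin.<-irrefl refl)
... | tri> _ _ b<a = contradiction (g↑ b a b<a) (Fin.<-asym ga<gb)

contains-of-occurrence : ∀ {n k} (σ : Permutation′ n) {π : Fin k → Fin k} (ι g : Fin k → Fin n) →
  StrictlyIncreasing ι → StrictlyIncreasing g → (∀ a → σ ⟨$⟩ʳ ι a ≡ g (π a)) → Contains σ π
contains-of-occurrence σ {π} ι g ι↑ g↑ σι≡gπ = ι , ι↑ , λ a b →
  (λ σa<σb → StrictlyIncreasing⇒reflects g↑ (subst₂ _<_ (σι≡gπ a) (σι≡gπ b) σa<σb)) ,
  (λ πa<πb → subst₂ _<_ (sym (σι≡gπ a)) (sym (σι≡gπ b)) (g↑ (π a) (π b) πa<πb))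

321-or-312 : ∀ {n} (σ : Permutation′ n) {x u v} → x < u → x < v →
             σ ⟨$⟩ʳ u < σ ⟨$⟩ʳ v → σ ⟨$⟩ʳ v < σ ⟨$⟩ʳ x → Contains σ p321 ⊎ Contains σ p312
321-or-312 {n} σ {x} {u} {v} x<u x<v σu<σv σv<σx = by-order (Fin.<-cmp u v)
  where
  values : Fin 3 → Fin n
  values = triple (σ ⟨$⟩ʳ u) (σ ⟨$⟩ʳ v) (σ ⟨$⟩ʳ x)
  occurrence : ∀ {π} ι → StrictlyIncreasing ι → (∀ a → σ ⟨$⟩ʳ ι a ≡ values (π a)) → Contains σ π
  occurrence ι ι↑ = contains-of-occurrence σ ι values ι↑ (triple-increasing σu<σv σv<σx)
  by-order : Tri (u < v) (u ≡ v) (v < u) → Contains σ p321 ⊎ Contains σ p312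
  by-order (tri< u<v _ _)  = inj₂ (occurrence (triple x u v) (triple-increasing x<u u<v)
                                              λ { 0F → refl ; 1F → refl ; 2F → refl })
  by-order (tri≈ _ refl _) = contradiction σu<σv (Fin.<-irrefl refl)
  by-order (tri> _ _ v<u)  = inj₁ (occurrence (triple x v u) (triple-increasing x<v v<u)
                                              λ { 0F → refl ; 1F → refl ; 2F → refl })

permMatrix-nonneg : ∀ {n} (σ : Permutation′ n) x y → 0ℤ ℤ.≤ permMatrix σ x y
permMatrix-nonneg σ x y with σ ⟨$⟩ʳ x Fin.≟ y
... | yes _ = +≤+ z≤n
... | no  _ = +≤+ z≤n

permMatrix-one : ∀ {n} (σ : Permutation′ n) {x y} → σ ⟨$⟩ʳ x ≡ y → permMatrix σ x y ≡ 1ℤ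
permMatrix-one σ {x} {y} σx≡y with σ ⟨$⟩ʳ x Fin.≟ y
... | yes _    = refl
... | no σx≢y  = contradiction σx≡y σx≢y

prefix≤0⇒ends-before-1 : ∀ {m} {f : Fin m → ℤ} → (∀ x → 0ℤ ℤ.≤ f x) → ∀ {x b} → f x ≡ 1ℤ → prefix f b ℤ.≤ 0ℤ → b ℕ.≤ toℕ x
prefix≤0⇒ends-before-1 0≤f {x} {b} fx≡1 prefix≤0 with toℕ x ℕ.<? b
... | yes x<b = contradiction (subst (ℤ._≤ 0ℤ) fx≡1 (ℤ.≤-trans (term≤prefix 0≤f x<b) prefix≤0)) λ { (+≤+ ()) }
... | no  x≮b = ℕ.≮⇒≥ x≮b

ThinCorner : ∀ {n} → Matrix n → ℕ → ℕ → Set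
ThinCorner M a b = cornerSum M a b ℤ.< + a × 1ℤ + cornerSum M a b ℤ.< + b

ThinCorner-≤ : ∀ {n} {M N : Matrix n} {a b} → cornerSum M a b ℤ.≤ cornerSum N a b → ThinCorner N a b → ThinCorner M a b
ThinCorner-≤ M≤N (rows , cols) = ℤ.≤-<-trans M≤N rows , ℤ.≤-<-trans (ℤ.+-monoʳ-≤ 1ℤ M≤N) cols

321⇒ThinCorner : ∀ {n} {A : Matrix n} → IsASM A → ClassicallyContains A p321 →
                 ∃₂ λ a b → a ℕ.≤ n × b ℕ.≤ n × ThinCorner A a b
321⇒ThinCorner {n} {A} asm (r , c , r↑ , c↑ , ones) =
  x₂ , suc y₂ , ℕ.<⇒≤ (Fin.toℕ<n (r 1F)) , Fin.toℕ<n (c 1F) , rows , ℤ.+-monoʳ-< 1ℤ cols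
  where
  x₂ y₂ : ℕ
  x₂ = toℕ (r 1F)
  y₂ = toℕ (c 1F)
  rows : cornerSum A x₂ (suc y₂) ℤ.< + x₂
  rows = cornerSum<height asm (ones 0F) (r↑ 0F 1F z<s) (c↑ 1F 2F (s<s z<s))
  cols : cornerSum A x₂ (suc y₂) ℤ.< + y₂
  cols = begin-strict
    cornerSum A x₂ (suc y₂)   ≡⟨ cornerSum-widen-at-1 asm (ones 1F) ⟩
    cornerSum A x₂ y₂         ≡⟨ cornerSum-flip A x₂ y₂ ⟩
    cornerSum (flip A) y₂ x₂  <⟨ cornerSum<height (IsASM-flip asm) (ones 2F) (c↑ 0F 1F z<s) (ℕ.<⇒≤ (r↑ 1F 2F (s<s z<s))) ⟩
    + y₂                      ∎
    where open ℤ.≤-Reasoning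

ThinCorner⇒321⊎312 : ∀ {n} (σ : Permutation′ n) {a b} → a ℕ.≤ n → b ℕ.≤ n → ThinCorner (permMatrix σ) a b →
                     Contains σ p321 ⊎ Contains σ p312
ThinCorner⇒321⊎312 {n} σ {a} {b} a≤n b≤n (rows , cols) =
  let x , x<a , rowx≤0 = prefix<length⇒∃≤0 _ a≤n rows
      z , z′ , z<z′ , z′<b , colz≤0 , colz′≤0 = 1+prefix<length⇒∃₂≤0 col-nonneg b≤n
        (subst (λ s → 1ℤ + s ℤ.< + b) (cornerSum-flip P a b) cols)
  in 321-or-312 σ (ℕ.<-≤-trans x<a (below z colz≤0)) (ℕ.<-≤-trans x<a (below z′ colz′≤0))
       (subst₂ _<_ (sym (inverseʳ σ)) (sym (inverseʳ σ)) z<z′)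
       (ℕ.<-≤-trans (subst (λ w → toℕ w ℕ.< b) (sym (inverseʳ σ)) z′<b)
                    (prefix≤0⇒ends-before-1 (permMatrix-nonneg σ x) (permMatrix-one σ refl) rowx≤0))
  where
  P : Matrix n
  P = permMatrix σ
  col-nonneg : ∀ y → 0ℤ ℤ.≤ prefix (flip P y) a
  col-nonneg y = prefix-nonneg (λ x → permMatrix-nonneg σ x y) a
  below : ∀ z → prefix (flip P z) a ℤ.≤ 0ℤ → a ℕ.≤ toℕ (σ ⟨$⟩ˡ z)
  below z = prefix≤0⇒ends-before-1 (λ x → permMatrix-nonneg σ x z) (permMatrix-one σ (inverseʳ σ))

lemma4p5 : ∀ (n : ℕ) (A : Matrix n) (σ : Permutation′ n) →
           IsASM A → SWKey A σ → Avoids σ p312 →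
           ClassicallyContains A p321 → Contains σ p321
lemma4p5 n A σ asm key avoids occurrence =
  let a , b , a≤n , b≤n , thin = 321⇒ThinCorner asm occurrence
      key≤A = cornerSum-steps key (IsASM⇒Entries≥-1 asm) a b
  in [ id , ⊥-elim ∘ avoids ]′ (ThinCorner⇒321⊎312 σ a≤n b≤n (ThinCorner-≤ {M = permMatrix σ} {A} key≤A thin))
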